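{- Let $p,q$ be positive integers and $d>1$ a divisor of $pq$. If $d$ divides $\gcd(p,q)$, then $H(p,q,d)$ is a line digraph, i.e. there is a digraph $G'$ such that $H(p,q,d)$ is isomorphic to $L(G')$.
   Context: For integers $a\le b$, $[a,b]=\{c\in\mathbb{Z}: a\le c\le b\}$. Digraphs may have loops and multiple arcs. For positive integers $p,q$, every $a\in[0,pq-1]$ is written uniquely as $a=iq+j$ with $i\in[0,p-1]$, $j\in[0,q-1]$, denoted $a=(i,j)_{p,q}$. For a divisor $d>1$ of $pq$, the digraph $H(p,q,d)$ has vertex set $[0,pq/d-1]$, where vertex $k$ represents the block $[kd,kd+d-1]$; for each $i\in[0,p-1]$, $j\in[0,q-1]$ there is one arc from the vertex whose block contains $iq+j$ to the vertex whose block contains $(q-1-j)p+(p-1-i)$ (arcs counted with multiplicity). The line digraph $L(G)$ of a digraph $G$ has the arcs of $G$ as vertices, with an arc from $(u,v)$ to $(v,w)$ whenever these are arcs of $G$. -}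

module Defs where

open import Data.Nat using (ℕ; _*_)
open import Data.Nat.Properties using (*-comm)
open import Data.Nat.Divisibility using (_∣_; divides)
open import Data.Fin using (Fin; combine; quotient; opposite; cast)
open import Data.Product using (Σ; _×_; _,_; proj₁; proj₂)
open import Function.Bundles using (_↔_; Inverse)
open import Relation.Binary.PropositionalEquality using (_≡_; trans)

record Digraph : Set₁ where
  constructor digraph
  field
    V   : Set
    A   : Set
    src : A → V
    tgt : A → V

open Digraph public

FinDigraph : (n m : ℕ) → (Fin m → Fin n) → (Fin m → Fin n) → Digraph
FinDigraph n m s t = digraph (Fin n) (Fin m) s t

record _≅_ (G H : Digraph) : Set where
  field
    isoV : V G ↔ V H
    isoA : A G ↔ A H
    src-comm : ∀ a → src H (Inverse.to isoA a) ≡ Inverse.to isoV (src G a)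
    tgt-comm : ∀ a → tgt H (Inverse.to isoA a) ≡ Inverse.to isoV (tgt G a)

L : Digraph → Digraph
L G = digraph (A G)
              (Σ (A G × A G) (λ ab → tgt G (proj₁ ab) ≡ src G (proj₂ ab)))
              (λ x → proj₁ (proj₁ x))
              (λ x → proj₂ (proj₁ x))

-- H(p,q,d) for d ∣ pq, with pq = e·d (e = quotient of the divisibility
-- witness). Vertex set Fin e = [0, pq/d - 1]; vertex k represents the
-- block [kd, kd+d-1], so the block containing a is a / d (= quotient d a).
-- Arcs are indexed by (i , j) ∈ Fin p × Fin q (one arc each):
--   from block of  i·q + j            (combine i j : Fin (p*q))
--   to   block of  (q-1-j)·p + (p-1-i) (combine (opposite j) (opposite i) : Fin (q*p)).
H : (p q d : ℕ) → d ∣ p * q → Digraph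
H p q d (divides e eq) =
  digraph (Fin e) (Fin p × Fin q)
    (λ ij → quotient d (cast eq (combine (proj₁ ij) (proj₂ ij))))
    (λ ij → quotient d (cast (trans (*-comm q p) eq)
                              (combine (opposite (proj₂ ij)) (opposite (proj₁ ij)))))

{-# OPTIONS --safe #-}
-- Write p = P d and q = Q d, so H has e = PQd vertices. Each vertex k has two mixed-radix
-- readings, k = I·Q + j (I < Pd, j < Q) and k = X·P + y (X < Qd, y < P). The arc (i , j₁d + j₂)
-- of H, with i = i₁d + i₂, leaves the vertex with I = i, j = j₁ and enters the vertex with
-- X = (Q-1-j₁)d + (d-1-j₂), y = P-1-i₁. So in the digraph G′ on [0, QP-1] whose arc k runs
-- from ⌊X/d⌋·P + y to (Q-1-j)·P + (P-1-⌊I/d⌋), the consecutive pairs of arcs of G′ are exactly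
-- the pairs (src a , tgt a) for arcs a of H, and H ≅ L(G′).
module Submission where

open import Defs
open import Axiom.UniquenessOfIdentityProofs using (UIP; module Decidable⇒UIP)
open import Data.Fin using (Fin; toℕ; combine; remQuot; quotient; remainder; opposite; cast)
open import Data.Fin.Properties
  using (toℕ<n; toℕ-cast; toℕ-combine; toℕ-injective; combine-remQuot; remQuot-combine;
         combine-injective; opposite-prop; opposite-involutive; cast-involutive)
  renaming (_≟_ to _≟ᶠ_)
open import Data.Nat using (ℕ; suc; _+_; _*_; _<_; NonZero; >-nonZero)
open import Data.Nat.Divisibility using (_∣_; divides; ∣-trans)
open import Data.Nat.GCD using (gcd; gcd[m,n]∣m; gcd[m,n]∣n)
open import Data.Nat.Properties using (*-comm; *-assoc; *-cancelʳ-≡; +-cancelʳ-≡; m∸n+n≡m; m<n⇒0<n)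
open import Data.Nat.Tactic.RingSolver using (solve-∀)
open import Data.Product using (Σ; _×_; _,_; proj₁; proj₂)
open import Function.Base using (_∘_)
open import Function.Bundles using (mk↔ₛ′)
open import Function.Construct.Identity using (↔-id)
open import Relation.Binary.PropositionalEquality
  using (_≡_; refl; sym; trans; cong; cong₂; subst; module ≡-Reasoning)
open ≡-Reasoning

private variable
  k m n o : ℕ

data CombineView (m n : ℕ) : Fin (m * n) → Set where
  combined : (i : Fin m) (j : Fin n) → CombineView m n (combine i j)

combineView : ∀ n (x : Fin (m * n)) → CombineView m n x
combineView {m} n x = subst (CombineView m n) (combine-remQuot {m} n x) (combined _ _)

quotient-combine : (i : Fin m) (j : Fin n) → quotient n (combine i j) ≡ i
quotient-combine i j = cong proj₁ (remQuot-combine i j)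

remainder-combine : (i : Fin m) (j : Fin n) → remainder {m} n (combine i j) ≡ j
remainder-combine i j = cong proj₂ (remQuot-combine i j)

toℕ-combine-assoc : (i : Fin m) (j : Fin n) (l : Fin o) →
                    toℕ (combine i (combine j l)) ≡ toℕ (combine (combine i j) l)
toℕ-combine-assoc {m} {n} {o} i j l = begin
  toℕ (combine i (combine j l))           ≡⟨ toℕ-combine i (combine j l) ⟩
  n * o * toℕ i + toℕ (combine j l)       ≡⟨ cong (n * o * toℕ i +_) (toℕ-combine j l) ⟩
  n * o * toℕ i + (o * toℕ j + toℕ l)     ≡⟨ reassoc n o (toℕ i) (toℕ j) (toℕ l) ⟩
  o * (n * toℕ i + toℕ j) + toℕ l         ≡⟨ cong (λ x → o * x + toℕ l) (toℕ-combine i j) ⟨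
  o * toℕ (combine i j) + toℕ l           ≡⟨ toℕ-combine (combine i j) l ⟨
  toℕ (combine (combine i j) l)           ∎
  where
  reassoc : ∀ n o a b c → n * o * a + (o * b + c) ≡ o * (n * a + b) + c
  reassoc = solve-∀

toℕ-opposite+suc : (i : Fin n) → toℕ (opposite i) + suc (toℕ i) ≡ n
toℕ-opposite+suc i = trans (cong (_+ suc (toℕ i)) (opposite-prop i)) (m∸n+n≡m (toℕ<n i))

-- Both sides become m * n after adding 1 + toℕ (combine i j).
opposite-combine : (i : Fin m) (j : Fin n) → opposite (combine i j) ≡ combine (opposite i) (opposite j)
opposite-combine {m} {n} i j = toℕ-injective (+-cancelʳ-≡ (suc (toℕ (combine i j))) _ _ (begin
  toℕ (opposite (combine i j)) + suc (toℕ (combine i j))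
                                           ≡⟨ toℕ-opposite+suc (combine i j) ⟩
  m * n                                    ≡⟨ cong (_* n) (toℕ-opposite+suc i) ⟨
  (i′ + suc (toℕ i)) * n                   ≡⟨ expand n i′ (toℕ i) ⟩
  n * i′ + n * toℕ i + n                   ≡⟨ cong (n * i′ + n * toℕ i +_) (toℕ-opposite+suc j) ⟨
  n * i′ + n * toℕ i + (j′ + suc (toℕ j))  ≡⟨ regroup n i′ (toℕ i) j′ (toℕ j) ⟩
  n * i′ + j′ + suc (n * toℕ i + toℕ j)    ≡⟨ cong₂ (λ a b → a + suc b)
                                                (toℕ-combine (opposite i) (opposite j)) (toℕ-combine i j) ⟨
  toℕ (combine (opposite i) (opposite j)) + suc (toℕ (combine i j))
                                           ∎))
  where
  i′ j′ : ℕ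
  i′ = toℕ (opposite i)
  j′ = toℕ (opposite j)
  expand : ∀ n a b → (a + suc b) * n ≡ n * a + n * b + n
  expand = solve-∀
  regroup : ∀ n a b c d → n * a + n * b + (c + suc d) ≡ n * a + c + suc (n * b + d)
  regroup = solve-∀

module Coordinates {m n k : ℕ} (eq : m * n ≡ k) where

  pack : Fin m × Fin n → Fin k
  pack (i , j) = cast eq (combine i j)

  unpack : Fin k → Fin m × Fin n
  unpack x = remQuot {m} n (cast (sym eq) x)

  unpack-pack : ∀ c → unpack (pack c) ≡ c
  unpack-pack (i , j) =
    trans (cong (remQuot {m} n) (cast-involutive (sym eq) eq (combine i j))) (remQuot-combine i j)

  pack-unpack : ∀ x → pack (unpack x) ≡ x
  pack-unpack x = trans (cong (cast eq) (combine-remQuot {m} n (cast (sym eq) x))) (cast-involutive eq (sym eq) x)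

quotient-cast-combine : .(eq : m * (n * o) ≡ k * o) .(eq′ : m * n ≡ k) (i : Fin m) (j : Fin n) (l : Fin o) →
                        quotient {k} o (cast eq (combine i (combine j l))) ≡ cast eq′ (combine i j)
quotient-cast-combine {o = o} {k} eq eq′ i j l =
  trans (cong (quotient o) (toℕ-injective (begin
    toℕ (cast eq (combine i (combine j l)))   ≡⟨ toℕ-cast eq (combine i (combine j l)) ⟩
    toℕ (combine i (combine j l))             ≡⟨ toℕ-combine-assoc i j l ⟩
    toℕ (combine (combine i j) l)             ≡⟨ toℕ-combine (combine i j) l ⟩
    o * toℕ (combine i j) + toℕ l             ≡⟨ cong (λ x → o * x + toℕ l) (toℕ-cast eq′ (combine i j)) ⟨
    o * toℕ (cast eq′ (combine i j)) + toℕ l  ≡⟨ toℕ-combine (cast eq′ (combine i j)) l ⟨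
    toℕ (combine (cast eq′ (combine i j)) l)  ∎)))
  (quotient-combine (cast eq′ (combine i j)) l)

≅-lineDigraph : (G : Digraph) {W : Set} → UIP W → (s t : V G → W) →
                (join : ∀ x → t (src G x) ≡ s (tgt G x)) →
                (split : ∀ a b → t a ≡ s b → A G) →
                (∀ a b e → src G (split a b e) ≡ a) →
                (∀ a b e → tgt G (split a b e) ≡ b) →
                (∀ x → split (src G x) (tgt G x) (join x) ≡ x) →
                G ≅ L (digraph W (V G) s t)
≅-lineDigraph G {W} uip s t join split src-split tgt-split split-join = record
  { isoV     = ↔-id (V G)
  ; isoA     = mk↔ₛ′ pair unpair pair-unpair split-join
  ; src-comm = λ _ → refl
  ; tgt-comm = λ _ → refl
  }
  where
  pair : A G → A (L (digraph W (V G) s t))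
  pair x = (src G x , tgt G x) , join x

  unpair : A (L (digraph W (V G) s t)) → A G
  unpair ((a , b) , e) = split a b e

  arc-≡ : ∀ {a a′ b b′} (e : t a ≡ s b) (e′ : t a′ ≡ s b′) → a ≡ a′ → b ≡ b′ →
          _≡_ {A = A (L (digraph W (V G) s t))} ((a , b) , e) ((a′ , b′) , e′)
  arc-≡ e e′ refl refl = cong (_ ,_) (uip e e′)

  pair-unpair : ∀ y → pair (unpair y) ≡ y
  pair-unpair ((a , b) , e) = arc-≡ _ e (src-split a b e) (tgt-split a b e)

IsFinLineDigraph : Digraph → Set
IsFinLineDigraph G = Σ ℕ (λ n → Σ ℕ (λ m → Σ (Fin m → Fin n) (λ s → Σ (Fin m → Fin n) (λ t →
  G ≅ L (FinDigraph n m s t)))))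

module H-asLineDigraph (P Q d e : ℕ) .{{_ : NonZero d}} (eq : P * d * (Q * d) ≡ e * d) where

  Hᵈ : Digraph
  Hᵈ = H (P * d) (Q * d) d (divides e eq)

  Pd*Q≡e : P * d * Q ≡ e
  Pd*Q≡e = *-cancelʳ-≡ _ _ d (trans (*-assoc (P * d) Q d) eq)

  Qd*P≡e : Q * d * P ≡ e
  Qd*P≡e = *-cancelʳ-≡ _ _ d (trans (*-assoc (Q * d) P d) (trans (*-comm (Q * d) (P * d)) eq))

  module PdQ = Coordinates {P * d} {Q} Pd*Q≡e
  module QdP = Coordinates {Q * d} {P} Qd*P≡e

  src-H : (i : Fin (P * d)) (j₁ : Fin Q) (j₂ : Fin d) → src Hᵈ (i , combine j₁ j₂) ≡ PdQ.pack (i , j₁)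
  src-H = quotient-cast-combine eq Pd*Q≡e

  tgt-H : (i₁ : Fin P) (i₂ : Fin d) (j₁ : Fin Q) (j₂ : Fin d) →
          tgt Hᵈ (combine i₁ i₂ , combine j₁ j₂)
            ≡ QdP.pack (combine (opposite j₁) (opposite j₂) , opposite i₁)
  tgt-H i₁ i₂ j₁ j₂ =
    trans (cong₂ (λ a b → quotient {e} d (cast eq′ (combine a b)))
                 (opposite-combine j₁ j₂) (opposite-combine i₁ i₂))
          (quotient-cast-combine eq′ Qd*P≡e (combine (opposite j₁) (opposite j₂)) (opposite i₁) (opposite i₂))
    where
    eq′ : Q * d * (P * d) ≡ e * d
    eq′ = trans (*-comm (Q * d) (P * d)) eq

  sᶜ : Fin (Q * d) × Fin P → Fin (Q * P)
  sᶜ (x , y) = combine (quotient {Q} d x) y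

  tᶜ : Fin (P * d) × Fin Q → Fin (Q * P)
  tᶜ (i , j) = combine (opposite j) (opposite (quotient {P} d i))

  s t : Fin e → Fin (Q * P)
  s = sᶜ ∘ QdP.unpack
  t = tᶜ ∘ PdQ.unpack

  sᶜ-combine : (x₁ : Fin Q) (x₂ : Fin d) (y : Fin P) → sᶜ (combine x₁ x₂ , y) ≡ combine x₁ y
  sᶜ-combine x₁ x₂ y = cong (λ x → combine x y) (quotient-combine x₁ x₂)

  tᶜ-combine : (i₁ : Fin P) (i₂ : Fin d) (j : Fin Q) → tᶜ (combine i₁ i₂ , j) ≡ combine (opposite j) (opposite i₁)
  tᶜ-combine i₁ i₂ j = cong (combine (opposite j) ∘ opposite) (quotient-combine i₁ i₂)

  join : ∀ x → t (src Hᵈ x) ≡ s (tgt Hᵈ x)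
  join (i , j) with combineView {P} d i | combineView {Q} d j
  ... | combined i₁ i₂ | combined j₁ j₂ = begin
    t (src Hᵈ (combine i₁ i₂ , combine j₁ j₂))
      ≡⟨ cong t (src-H _ j₁ j₂) ⟩
    tᶜ (PdQ.unpack (PdQ.pack (combine i₁ i₂ , j₁)))
      ≡⟨ cong tᶜ (PdQ.unpack-pack _) ⟩
    tᶜ (combine i₁ i₂ , j₁)
      ≡⟨ tᶜ-combine i₁ i₂ j₁ ⟩
    combine (opposite j₁) (opposite i₁)
      ≡⟨ sᶜ-combine _ (opposite j₂) _ ⟨
    sᶜ (combine (opposite j₁) (opposite j₂) , opposite i₁)
      ≡⟨ cong sᶜ (QdP.unpack-pack _) ⟨
    s (QdP.pack (combine (opposite j₁) (opposite j₂) , opposite i₁))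
      ≡⟨ cong s (tgt-H i₁ i₂ j₁ j₂) ⟨
    s (tgt Hᵈ (combine i₁ i₂ , combine j₁ j₂))
      ∎

  -- i and j₁ are read off the source; j₂ = d-1-(X mod d) is read off the target.
  splitᶜ : Fin (P * d) × Fin Q → Fin (Q * d) × Fin P → A Hᵈ
  splitᶜ (i , j) (x , _) = i , combine j (opposite (remainder {Q} d x))

  split : Fin e → Fin e → A Hᵈ
  split a b = splitᶜ (PdQ.unpack a) (QdP.unpack b)

  src-split : ∀ a b → src Hᵈ (split a b) ≡ a
  src-split a b = trans (src-H _ _ _) (PdQ.pack-unpack a)

  tgt-splitᶜ : ∀ u v → tᶜ u ≡ sᶜ v → tgt Hᵈ (splitᶜ u v) ≡ QdP.pack v
  tgt-splitᶜ (i , j) (x , y) tu≡sv with combineView {P} d i | combineView {Q} d x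
  ... | combined i₁ i₂ | combined x₁ x₂
    with combine-injective (opposite j) (opposite i₁) x₁ y
           (trans (sym (tᶜ-combine i₁ i₂ j)) (trans tu≡sv (sᶜ-combine x₁ x₂ y)))
  ... | refl , refl = begin
    tgt Hᵈ (combine i₁ i₂ , combine j (opposite (remainder {Q} d (combine (opposite j) x₂))))
      ≡⟨ cong (λ r → tgt Hᵈ (combine i₁ i₂ , combine j (opposite r))) (remainder-combine (opposite j) x₂) ⟩
    tgt Hᵈ (combine i₁ i₂ , combine j (opposite x₂))
      ≡⟨ tgt-H i₁ i₂ j (opposite x₂) ⟩
    QdP.pack (combine (opposite j) (opposite (opposite x₂)) , opposite i₁)
      ≡⟨ cong (λ r → QdP.pack (combine (opposite j) r , opposite i₁)) (opposite-involutive x₂) ⟩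
    QdP.pack (combine (opposite j) x₂ , opposite i₁)
      ∎

  tgt-split : ∀ a b → t a ≡ s b → tgt Hᵈ (split a b) ≡ b
  tgt-split a b ta≡sb = trans (tgt-splitᶜ _ _ ta≡sb) (QdP.pack-unpack b)

  split-join : ∀ x → split (src Hᵈ x) (tgt Hᵈ x) ≡ x
  split-join (i , j) with combineView {P} d i | combineView {Q} d j
  ... | combined i₁ i₂ | combined j₁ j₂ = begin
    split (src Hᵈ (combine i₁ i₂ , combine j₁ j₂)) (tgt Hᵈ (combine i₁ i₂ , combine j₁ j₂))
      ≡⟨ cong₂ split (src-H _ j₁ j₂) (tgt-H i₁ i₂ j₁ j₂) ⟩
    split (PdQ.pack (combine i₁ i₂ , j₁)) (QdP.pack (combine (opposite j₁) (opposite j₂) , opposite i₁))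
      ≡⟨ cong₂ splitᶜ (PdQ.unpack-pack _) (QdP.unpack-pack _) ⟩
    combine i₁ i₂ , combine j₁ (opposite (remainder {Q} d (combine (opposite j₁) (opposite j₂))))
      ≡⟨ cong (λ r → combine i₁ i₂ , combine j₁ (opposite r)) (remainder-combine (opposite j₁) (opposite j₂)) ⟩
    combine i₁ i₂ , combine j₁ (opposite (opposite j₂))
      ≡⟨ cong (λ r → combine i₁ i₂ , combine j₁ r) (opposite-involutive j₂) ⟩
    combine i₁ i₂ , combine j₁ j₂
      ∎

  isFinLineDigraph : IsFinLineDigraph Hᵈ
  isFinLineDigraph = Q * P , e , s , t ,
    ≅-lineDigraph Hᵈ (Decidable⇒UIP.≡-irrelevant _≟ᶠ_) s t join (λ a b _ → split a b)
                  (λ a b _ → src-split a b) tgt-split split-join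

theorem3p2 : (p q d : ℕ) → NonZero p → NonZero q → 1 < d →
    (d∣pq : d ∣ p * q) → d ∣ gcd p q →
    Σ ℕ (λ n → Σ ℕ (λ m → Σ (Fin m → Fin n) (λ s → Σ (Fin m → Fin n) (λ t →
      H p q d d∣pq ≅ L (FinDigraph n m s t)))))
theorem3p2 p q d _ _ 1<d d∣pq d∣gcd
  with ∣-trans d∣gcd (gcd[m,n]∣m p q) | ∣-trans d∣gcd (gcd[m,n]∣n p q) | d∣pq
... | divides P refl | divides Q refl | divides e eq =
  H-asLineDigraph.isFinLineDigraph P Q d e {{>-nonZero (m<n⇒0<n 1<d)}} eq
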